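{- For every integer $m\ge 3$, the cycle $C_m$ of length $m$ is a $\langle 2,2\rangle$ CCE graph.
   Context: All graphs and digraphs are simple (no loops, no multiple arcs). The CCE graph $CCE(D)$ of a digraph $D$ is the graph on $V(D)$ in which distinct $u,v$ are adjacent iff there exist vertices $x,y$ with $(y,u),(y,v),(u,x),(v,x)$ all arcs of $D$. A $\langle 2,2\rangle$ digraph is a digraph in which every vertex has indegree at most $2$ and outdegree at most $2$; a $\langle 2,2\rangle$ CCE graph is a graph isomorphic to the CCE graph of some $\langle 2,2\rangle$ digraph. -}

module Defs where

open import Data.Nat using (ℕ; suc; _+_; _≤_; _%_; NonZero)
open import Data.Bool using (Bool; true; false; T)
open import Data.Fin using (Fin; toℕ)
open import Data.List using (List; filter; length)
open import Data.List.Base using (allFin)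
open import Data.Product using (Σ; _×_; ∃; ∃-syntax)
open import Data.Sum using (_⊎_)
open import Relation.Nullary using (¬_)
open import Relation.Binary.PropositionalEquality using (_≡_)
open import Data.Bool.Properties using (T?)
open import Function.Bundles using (_↔_; Inverse; _⇔_)

record Digraph (n : ℕ) : Set where
  field
    arc     : Fin n → Fin n → Bool
    loopless : ∀ v → arc v v ≡ false
open Digraph public

outdeg : ∀ {n} → Digraph n → Fin n → ℕ
outdeg {n} D v = length (filter (λ x → T? (arc D v x)) (allFin n))

indeg : ∀ {n} → Digraph n → Fin n → ℕ
indeg {n} D v = length (filter (λ y → T? (arc D y v)) (allFin n))

Is22 : ∀ {n} → Digraph n → Set
Is22 D = ∀ v → indeg D v ≤ 2 × outdeg D v ≤ 2

-- A graph on a vertex type, given by its adjacency relation.  (Symmetry and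
-- irreflexivity hold for the two concrete graphs used below: CCE graphs and cycles.)
record Graph (V : Set) : Set₁ where
  field
    Adj : V → V → Set
open Graph public

CCEAdj : ∀ {n} → Digraph n → Fin n → Fin n → Set
CCEAdj {n} D u v = ¬ (u ≡ v) × ∃[ x ] ∃[ y ]
  (T (arc D y u) × T (arc D y v) × T (arc D u x) × T (arc D v x))

CCE : ∀ {n} → Digraph n → Graph (Fin n)
CCE D = record { Adj = CCEAdj D }

CycleAdj : (m : ℕ) → 3 ≤ m → Fin m → Fin m → Set
CycleAdj (suc m) _ i j = toℕ j ≡ (suc (toℕ i)) % suc m ⊎ toℕ i ≡ (suc (toℕ j)) % suc m

cycleGraph : (m : ℕ) → 3 ≤ m → Graph (Fin m)
cycleGraph m h = record { Adj = CycleAdj m h }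

_≅_ : ∀ {V W : Set} → Graph V → Graph W → Set
_≅_ {V} {W} G H = Σ (V ↔ W) λ f →
  ∀ u v → Adj G u v ⇔ Adj H (Inverse.to f u) (Inverse.to f v)

-- Let σ be the rotation i ↦ i + 1 of ℤ/m and join every vertex i to σ i and σ² i.
-- Each vertex then has in- and outdegree 2.  Two distinct vertices with a common
-- in-neighbour y are {σ y, σ² y}, i.e. consecutive on the cycle; conversely i and
-- σ i have the common in-neighbour σ⁻¹ i and the common out-neighbour σ² i.  So the
-- CCE graph is C_m itself, as long as neither σ nor σ² fixes a vertex (m ≥ 3).
module Submission where

open import Defs
open import Data.Nat using (ℕ; _≤_)
open import Data.Product using (Σ; _×_; ∃-syntax)
open import Data.Fin using (Fin)

open import Data.Nat using (zero; suc; _+_; _*_; _<_; _%_; _/_; NonZero; z≤n; s≤s)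
open import Data.Nat.Properties
  using (+-comm; +-assoc; +-cancelʳ-≡; m≤m+n; <-irrefl; <⇒≱; <-trans; n<1+n)
open import Data.Nat.DivMod
  using (m≡m%n+[m/n]*n; %-distribˡ-+; m%n%n≡m%n; [m+n]%n≡m%n; m%n<n; m<n⇒m%n≡m)
open import Data.Fin using (toℕ; fromℕ<; _≟_)
open import Data.Fin.Properties using (toℕ-fromℕ<; toℕ-injective; toℕ<n)
open import Data.Fin.Permutation using (Permutation′; permutation; _⟨$⟩ʳ_; _⟨$⟩ˡ_; inverseˡ; inverseʳ)
open import Data.Bool using (T)
open import Data.Bool.Properties using (T?)
open import Data.List using (List; []; _∷_; length; filter)
open import Data.List.Base using (allFin)
open import Data.List.Relation.Unary.All as All using (All; _∷_)
open import Data.List.Relation.Unary.All.Properties using (all-filter)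
open import Data.List.Relation.Unary.AllPairs using (_∷_)
open import Data.List.Relation.Unary.Unique.Propositional using (Unique)
import Data.List.Relation.Unary.Unique.Propositional.Properties as Unique
open import Data.Product using (_,_)
open import Data.Sum using (_⊎_; inj₁; inj₂)
open import Data.Sum.Function.Propositional using (_⊎-⇔_)
open import Data.Empty using (⊥-elim)
open import Relation.Nullary using (¬_; Dec)
open import Relation.Nullary.Decidable using (isYes; isYes≗does; dec-false; toWitness; fromWitness; _⊎-dec_)
open import Level using (0ℓ)
open import Relation.Unary using (Pred; Decidable)
open import Relation.Binary.PropositionalEquality
  using (_≡_; _≢_; refl; sym; trans; cong; module ≡-Reasoning)
open import Function.Bundles using (_⇔_; mk⇔)
open import Function.Construct.Identity using (↔-id)
open import Function.Construct.Composition using (_⇔-∘_)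

module _ {A : Set} where

  length≤1 : ∀ {b} {xs : List A} → Unique xs → All (_≡ b) xs → length xs ≤ 1
  length≤1 {xs = []}        _               _               = z≤n
  length≤1 {xs = _ ∷ []}    _               _               = s≤s z≤n
  length≤1 {xs = _ ∷ _ ∷ _} ((x≢y ∷ _) ∷ _) (x≡b ∷ y≡b ∷ _) = ⊥-elim (x≢y (trans x≡b (sym y≡b)))

  length≤2 : ∀ {a b} {xs : List A} → Unique xs → All (λ x → x ≡ a ⊎ x ≡ b) xs → length xs ≤ 2
  length≤2 {xs = []} _ _ = z≤n
  length≤2 (x≢xs ∷ u) (inj₁ refl ∷ xs∈ab) =
    s≤s (length≤1 u (All.zipWith (λ { (x≢y , inj₁ y≡x) → ⊥-elim (x≢y (sym y≡x))
                                    ; (_   , inj₂ y≡b) → y≡b })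
                                 (x≢xs , xs∈ab)))
  length≤2 (x≢xs ∷ u) (inj₂ refl ∷ xs∈ab) =
    s≤s (length≤1 u (All.zipWith (λ { (_   , inj₁ y≡a) → y≡a
                                    ; (x≢y , inj₂ y≡x) → ⊥-elim (x≢y (sym y≡x)) })
                                 (x≢xs , xs∈ab)))

filter-allFin-length≤2 : ∀ {n} {P : Pred (Fin n) 0ℓ} (P? : Decidable P) {a b : Fin n} →
                         (∀ x → P x → x ≡ a ⊎ x ≡ b) → length (filter P? (allFin n)) ≤ 2
filter-allFin-length≤2 {n} P? P⊆ab =
  length≤2 (Unique.filter⁺ P? (Unique.allFin⁺ n)) (All.map (P⊆ab _) (all-filter P? (allFin n)))

outdeg≤2 : ∀ {n} (D : Digraph n) v {a b} → (∀ x → T (arc D v x) → x ≡ a ⊎ x ≡ b) → outdeg D v ≤ 2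
outdeg≤2 D v = filter-allFin-length≤2 (λ x → T? (arc D v x))

indeg≤2 : ∀ {n} (D : Digraph n) v {a b} → (∀ y → T (arc D y v) → y ≡ a ⊎ y ≡ b) → indeg D v ≤ 2
indeg≤2 D v = filter-allFin-length≤2 (λ y → T? (arc D y v))

relDigraph : ∀ {n} {R : Fin n → Fin n → Set} → (∀ u v → Dec (R u v)) → (∀ v → ¬ R v v) → Digraph n
relDigraph R? irrefl = record
  { arc      = λ u v → isYes (R? u v)
  ; loopless = λ v → trans (isYes≗does (R? v v)) (dec-false (R? v v) (irrefl v))
  }

module Circulant {n} (σ : Permutation′ n)
  (σ-fixfree : ∀ v → σ ⟨$⟩ʳ v ≢ v) (σ²-fixfree : ∀ v → σ ⟨$⟩ʳ (σ ⟨$⟩ʳ v) ≢ v) where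

  next prev : Fin n → Fin n
  next = σ ⟨$⟩ʳ_
  prev = σ ⟨$⟩ˡ_

  Step : Fin n → Fin n → Set
  Step u x = x ≡ next u ⊎ x ≡ next (next u)

  step? : ∀ u x → Dec (Step u x)
  step? u x = (x ≟ next u) ⊎-dec (x ≟ next (next u))

  step-irrefl : ∀ v → ¬ Step v v
  step-irrefl v (inj₁ v≡σv)  = σ-fixfree v (sym v≡σv)
  step-irrefl v (inj₂ v≡σ²v) = σ²-fixfree v (sym v≡σ²v)

  digraph : Digraph n
  digraph = relDigraph step? step-irrefl

  step-back : ∀ {y v} → Step y v → y ≡ prev v ⊎ y ≡ prev (prev v)
  step-back (inj₁ refl) = inj₁ (sym (inverseˡ σ))
  step-back (inj₂ refl) = inj₂ (sym (trans (cong prev (inverseˡ σ)) (inverseˡ σ)))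

  is22 : Is22 digraph
  is22 v = indeg≤2 digraph v (λ y y→v → step-back (toWitness y→v))
         , outdeg≤2 digraph v (λ x v→x → toWitness v→x)

  consecutive⇒CCEAdj : ∀ {u v} → v ≡ next u → CCEAdj digraph u v
  consecutive⇒CCEAdj {u} refl =
      (λ u≡σu → σ-fixfree u (sym u≡σu))
    , next (next u) , prev u
    , fromWitness (inj₁ (sym (inverseʳ σ)))
    , fromWitness (inj₂ (cong next (sym (inverseʳ σ))))
    , fromWitness (inj₂ refl)
    , fromWitness (inj₁ refl)

  CCEAdj-sym : ∀ {u v} → CCEAdj digraph u v → CCEAdj digraph v u
  CCEAdj-sym (u≢v , x , y , yu , yv , ux , vx) = (λ v≡u → u≢v (sym v≡u)) , x , y , yv , yu , vx , ux

  CCEAdj⇔consecutive : ∀ u v → CCEAdj digraph u v ⇔ (v ≡ next u ⊎ u ≡ next v)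
  CCEAdj⇔consecutive u v = mk⇔ to from
    where
    to : CCEAdj digraph u v → v ≡ next u ⊎ u ≡ next v
    to (u≢v , _ , y , yu , yv , _) with toWitness yu | toWitness yv
    ... | inj₁ u≡σy | inj₁ v≡σy   = ⊥-elim (u≢v (trans u≡σy (sym v≡σy)))
    ... | inj₁ refl | inj₂ refl   = inj₁ refl
    ... | inj₂ refl | inj₁ refl   = inj₂ refl
    ... | inj₂ u≡σ²y | inj₂ v≡σ²y = ⊥-elim (u≢v (trans u≡σ²y (sym v≡σ²y)))
    from : v ≡ next u ⊎ u ≡ next v → CCEAdj digraph u v
    from (inj₁ v≡σu) = consecutive⇒CCEAdj v≡σu
    from (inj₂ u≡σv) = CCEAdj-sym (consecutive⇒CCEAdj u≡σv)

[m+n%d]%d≡[m+n]%d : ∀ m n d .{{_ : NonZero d}} → (m + n % d) % d ≡ (m + n) % d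
[m+n%d]%d≡[m+n]%d m n d = begin
  (m + n % d) % d           ≡⟨ %-distribˡ-+ m (n % d) d ⟩
  (m % d + n % d % d) % d   ≡⟨ cong (λ r → (m % d + r) % d) (m%n%n≡m%n n d) ⟩
  (m % d + n % d) % d       ≡⟨ %-distribˡ-+ m n d ⟨
  (m + n) % d               ∎
  where open ≡-Reasoning

0<k<m⇒k≢q*m : ∀ {k m} q → 0 < k → k < m → k ≢ q * m
0<k<m⇒k≢q*m zero    0<k _   refl = <-irrefl refl 0<k
0<k<m⇒k≢q*m {m = m} (suc q) _ k<m refl = <⇒≱ k<m (m≤m+n m (q * m))

-- k + i ≡ i (mod m) would make k a multiple of m.
[k+i]%m≢i : ∀ {k i m} .{{_ : NonZero m}} → 0 < k → k < m → (k + i) % m ≢ i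
[k+i]%m≢i {k} {i} {m} 0<k k<m eq = 0<k<m⇒k≢q*m q 0<k k<m (+-cancelʳ-≡ i k (q * m) (begin
  k + i               ≡⟨ m≡m%n+[m/n]*n (k + i) m ⟩
  (k + i) % m + q * m ≡⟨ cong (_+ q * m) eq ⟩
  i + q * m           ≡⟨ +-comm i (q * m) ⟩
  q * m + i           ∎))
  where
  open ≡-Reasoning
  q = (k + i) / m

module _ {n : ℕ} where

  rotate : ℕ → Fin (suc n) → Fin (suc n)
  rotate k i = fromℕ< (m%n<n (k + toℕ i) (suc n))

  toℕ-rotate : ∀ k i → toℕ (rotate k i) ≡ (k + toℕ i) % suc n
  toℕ-rotate k i = toℕ-fromℕ< (m%n<n (k + toℕ i) (suc n))

  rotate-rotate : ∀ k l i → rotate k (rotate l i) ≡ rotate (k + l) i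
  rotate-rotate k l i = toℕ-injective (begin
    toℕ (rotate k (rotate l i))  ≡⟨ toℕ-rotate k (rotate l i) ⟩
    (k + toℕ (rotate l i)) % m  ≡⟨ cong (λ r → (k + r) % m) (toℕ-rotate l i) ⟩
    (k + (l + toℕ i) % m) % m   ≡⟨ [m+n%d]%d≡[m+n]%d k (l + toℕ i) m ⟩
    (k + (l + toℕ i)) % m       ≡⟨ cong (_% m) (+-assoc k l (toℕ i)) ⟨
    (k + l + toℕ i) % m         ≡⟨ toℕ-rotate (k + l) i ⟨
    toℕ (rotate (k + l) i)      ∎)
    where
    open ≡-Reasoning
    m = suc n

  rotate-full : ∀ i → rotate (suc n) i ≡ i
  rotate-full i = toℕ-injective (begin
    toℕ (rotate (suc n) i)  ≡⟨ toℕ-rotate (suc n) i ⟩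
    (suc n + toℕ i) % suc n ≡⟨ cong (_% suc n) (+-comm (suc n) (toℕ i)) ⟩
    (toℕ i + suc n) % suc n ≡⟨ [m+n]%n≡m%n (toℕ i) (suc n) ⟩
    toℕ i % suc n           ≡⟨ m<n⇒m%n≡m (toℕ<n i) ⟩
    toℕ i                   ∎)
    where open ≡-Reasoning

  rotate-fixfree : ∀ {k} i → 0 < k → k < suc n → rotate k i ≢ i
  rotate-fixfree {k} i 0<k k<m eq = [k+i]%m≢i 0<k k<m (trans (sym (toℕ-rotate k i)) (cong toℕ eq))

  shift : Permutation′ (suc n)
  shift = permutation (rotate 1) (rotate n)
    (λ i → trans (rotate-rotate 1 n i) (rotate-full i))
    (λ i → trans (rotate-rotate n 1 i) (trans (cong (λ k → rotate k i) (+-comm n 1)) (rotate-full i)))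

  shift-fixfree : 1 < suc n → ∀ v → shift ⟨$⟩ʳ v ≢ v
  shift-fixfree 1<m v = rotate-fixfree v (s≤s z≤n) 1<m

  shift²-fixfree : 2 < suc n → ∀ v → shift ⟨$⟩ʳ (shift ⟨$⟩ʳ v) ≢ v
  shift²-fixfree 2<m v eq = rotate-fixfree v (s≤s z≤n) 2<m (trans (sym (rotate-rotate 1 1 v)) eq)

  ≡shift⇔toℕ≡suc% : ∀ u v → (v ≡ shift ⟨$⟩ʳ u) ⇔ (toℕ v ≡ suc (toℕ u) % suc n)
  ≡shift⇔toℕ≡suc% u v = mk⇔ (λ v≡σu → trans (cong toℕ v≡σu) (toℕ-rotate 1 u))
                            (λ eq → toℕ-injective (trans eq (sym (toℕ-rotate 1 u))))

lemma3p3 : (m : ℕ) (3≤m : 3 ≤ m) →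
    ∃[ n ] Σ (Digraph n) λ D → Is22 D × (CCE D ≅ cycleGraph m 3≤m)
lemma3p3 (suc n) 3≤m = suc n , digraph , is22 , ↔-id (Fin (suc n)) ,
  λ u v → (≡shift⇔toℕ≡suc% u v ⊎-⇔ ≡shift⇔toℕ≡suc% v u) ⇔-∘ CCEAdj⇔consecutive u v
  where
  open Circulant shift (shift-fixfree (<-trans (n<1+n 1) 3≤m)) (shift²-fixfree 3≤m)
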